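{- Let $\mathcal S=(\mathit{Sign},\mathit{Sen},\Omega,T)$ be a $\frac32$-institutional seed. Then in $\mathcal I(\mathcal S)$ every $\mathit{Sen}$-maximal signature morphism $\varphi$ is $\mathit{Mod}$-strict, i.e. for every signature morphism $\theta$ with $\operatorname{cod}\theta=\operatorname{dom}\varphi$ and every $\operatorname{cod}\varphi$-model $M''$, $\bigcup_{M'\in\mathit{Mod}(\varphi)M''}\mathit{Mod}(\theta)M'=\mathit{Mod}(\theta;\varphi)M''$.
   Context: Composition is diagrammatic. A $\frac32$-category is a category with partially ordered hom-sets and monotone composition. $\mathbf{Pfn}$: sets and partial functions ordered by graph inclusion. A $\frac32$-institutional seed $(\mathit{Sign},\mathit{Sen},\Omega,T)$: a $\frac32$-category $\mathit{Sign}$, a lax $\frac32$-functor $\mathit{Sen}:\mathit{Sign}\to\mathbf{Pfn}$ (monotone: $\varphi\le\theta\Rightarrow\mathit{Sen}(\varphi)\subseteq\mathit{Sen}(\theta)$; $\mathit{Sen}(\varphi);\mathit{Sen}(\varphi')\subseteq\mathit{Sen}(\varphi;\varphi')$; $1\subseteq\mathit{Sen}(1_\Sigma)$), an object $\Omega$, $T:\mathit{Sen}(\Omega)\to\{0,1\}$. In the associated $\frac32$-institution $\mathcal I(\mathcal S)$: $\Sigma$-models are arrows $M:\Sigma\to\Omega$ with $\mathit{Sen}(M)$ total; $\mathit{Mod}(\varphi)M'=\{M\text{ a }\operatorname{dom}\varphi\text{ -model}\mid\varphi;M'\le M\}$; $M\models\rho$ iff $T(\mathit{Sen}(M)\rho)=1$.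 A signature morphism $\varphi$ is $\mathit{Sen}$-maximal if $\mathit{Sen}(\varphi)$ is a total function. -}

module Defs where

open import Level using (Level; _⊔_) renaming (suc to lsuc)
open import Data.Maybe using (Maybe; just; nothing)
open import Data.Bool using (Bool; true)
open import Data.Product using (Σ; ∃; _×_; _,_; proj₁)
open import Relation.Binary.PropositionalEquality using (_≡_)
open import Relation.Binary.Structures using (IsPartialOrder)

-- Partial functions A ⇀ B (arrows of Pfn), ordered by graph inclusion.
_⇀_ : ∀ {a b} → Set a → Set b → Set (a ⊔ b)
A ⇀ B = A → Maybe B

_⊑_ : ∀ {a b} {A : Set a} {B : Set b} → (A ⇀ B) → (A ⇀ B) → Set (a ⊔ b)
f ⊑ g = ∀ x y → f x ≡ just y → g x ≡ just y

_；ᵖ_ : ∀ {a b c} {A : Set a} {B : Set b} {C : Set c} → (A ⇀ B) → (B ⇀ C) → (A ⇀ C)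
(f ；ᵖ g) x with f x
... | just y  = g y
... | nothing = nothing

idᵖ : ∀ {a} {A : Set a} → A ⇀ A
idᵖ x = just x

Total : ∀ {a b} {A : Set a} {B : Set b} → (A ⇀ B) → Set (a ⊔ b)
Total f = ∀ x → ∃ λ y → f x ≡ just y

record ThreeHalvesCat (o h r : Level) : Set (lsuc (o ⊔ h ⊔ r)) where
  infixr 9 _；_
  field
    Obj    : Set o
    Hom    : Obj → Obj → Set h
    _≤_    : ∀ {A B} → Hom A B → Hom A B → Set r
    isPO   : ∀ {A B} → IsPartialOrder (_≡_ {A = Hom A B}) _≤_
    id     : ∀ {A} → Hom A A
    _；_    : ∀ {A B C} → Hom A B → Hom B C → Hom A C
    idˡ    : ∀ {A B} (f : Hom A B) → id ； f ≡ f
    idʳ    : ∀ {A B} (f : Hom A B) → f ； id ≡ f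
    assoc  : ∀ {A B C D} (f : Hom A B) (g : Hom B C) (k : Hom C D) →
             (f ； g) ； k ≡ f ； (g ； k)
    ；-mono : ∀ {A B C} {f f′ : Hom A B} {g g′ : Hom B C} →
             f ≤ f′ → g ≤ g′ → (f ； g) ≤ (f′ ； g′)

-- 3/2-institutional seed (Sign, Sen, Ω, T), Sen a lax 3/2-functor into Pfn.
record Seed (o h r s : Level) : Set (lsuc (o ⊔ h ⊔ r ⊔ s)) where
  field
    Sign : ThreeHalvesCat o h r
  open ThreeHalvesCat Sign public
  field
    Sen      : Obj → Set s
    Sen₁     : ∀ {A B} → Hom A B → (Sen A ⇀ Sen B)
    Sen-mono : ∀ {A B} {φ θ : Hom A B} → φ ≤ θ → Sen₁ φ ⊑ Sen₁ θ
    Sen-comp : ∀ {A B C} (φ : Hom A B) (φ′ : Hom B C) →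
               (Sen₁ φ ；ᵖ Sen₁ φ′) ⊑ Sen₁ (φ ； φ′)
    Sen-id   : ∀ {A} → idᵖ ⊑ Sen₁ (id {A})
    Ω        : Obj
    T        : Sen Ω → Bool

  Model : Obj → Set (h ⊔ s)
  Model A = Σ (Hom A Ω) λ M → Total (Sen₁ M)

  -- Mod(φ) M' as a predicate on dom φ - models:  φ ; M' ≤ M
  Mod : ∀ {A B} → Hom A B → Model B → Model A → Set r
  Mod φ M′ M = (φ ； proj₁ M′) ≤ proj₁ M

  _⊨_ : ∀ {A} → Model A → Sen A → Set s
  M ⊨ ρ = ∀ ρ′ → Sen₁ (proj₁ M) ρ ≡ just ρ′ → T ρ′ ≡ true

  SenMaximal : ∀ {A B} → Hom A B → Set s
  SenMaximal φ = Total (Sen₁ φ)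

  ModStrict : ∀ {A B} → Hom A B → Set (o ⊔ h ⊔ r ⊔ s)
  ModStrict {A} {B} φ =
    ∀ {C} (θ : Hom C A) (M″ : Model B) (M : Model C) →
      ((Σ (Model A) λ M′ → Mod φ M″ M′ × Mod θ M′ M) → Mod (θ ； φ) M″ M)
      × (Mod (θ ； φ) M″ M → Σ (Model A) λ M′ → Mod φ M″ M′ × Mod θ M′ M)

module Submission where

-- The inclusion  ⋃_{M′ ∈ Mod(φ)M″} Mod(θ)M′ ⊆ Mod(θ;φ)M″  holds for every φ:
-- from φ;M″ ≤ M′ and θ;M′ ≤ M, monotonicity of composition gives
-- θ;φ;M″ ≤ θ;M′ ≤ M.
--
-- For the converse, Sen-maximality is exactly what makes φ;M″ itself an
-- A-model: Sen(φ) and Sen(M″) are total, hence so is their composite in Pfn,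
-- and laxity of Sen gives Sen(φ);Sen(M″) ⊆ Sen(φ;M″), a total graph inside
-- a partial function forcing the latter to be total.  This translated model
-- belongs to Mod(φ)M″ by reflexivity, and every M ∈ Mod(θ;φ)M″ lies in
-- Mod(θ)(φ;M″) by associativity, so φ;M″ witnesses the union.

open import Defs
open import Level using (Level)
open import Data.Product using (Σ; _×_; _,_; proj₁; proj₂)
open import Data.Maybe using (just)
open import Relation.Binary.PropositionalEquality using (refl; subst; sym)
open import Relation.Binary.Structures using (IsPartialOrder)

⊑-preserves-Total : ∀ {a b} {A : Set a} {B : Set b} {f g : A ⇀ B} →
                    f ⊑ g → Total f → Total g
⊑-preserves-Total f⊑g total-f x =
  let (y , fx≡y) = total-f x in y , f⊑g x y fx≡y

；ᵖ-preserves-Total : ∀ {a b c} {A : Set a} {B : Set b} {C : Set c}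
                      {f : A ⇀ B} {g : B ⇀ C} →
                      Total f → Total g → Total (f ；ᵖ g)
；ᵖ-preserves-Total {f = f} {g} total-f total-g x with f x | total-f x
... | .(just y) | y , refl = total-g y

module SeedFacts {o h r s : Level} (S : Seed o h r s) where
  open Seed S
  module ≤ {X Y : Obj} = IsPartialOrder (isPO {X} {Y})

  -- Laxity of Sen: composing Sen-maximal morphisms gives a Sen-maximal one.
  SenMaximal-； : ∀ {X Y Z} {φ : Hom X Y} {ψ : Hom Y Z} →
                 SenMaximal φ → SenMaximal ψ → SenMaximal (φ ； ψ)
  SenMaximal-； {φ = φ} {ψ} max-φ max-ψ =
    ⊑-preserves-Total (Sen-comp φ ψ) (；ᵖ-preserves-Total max-φ max-ψ)

  translate : ∀ {X Y} (φ : Hom X Y) → SenMaximal φ → Model Y → Model X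
  translate φ max-φ M″ = φ ； proj₁ M″ , SenMaximal-； max-φ (proj₂ M″)

  translate∈Mod : ∀ {X Y} (φ : Hom X Y) (max-φ : SenMaximal φ) (M″ : Model Y) →
                  Mod φ M″ (translate φ max-φ M″)
  translate∈Mod φ max-φ M″ = ≤.refl

  Mod-；-translate : ∀ {W X Y} (θ : Hom W X) (φ : Hom X Y) (max-φ : SenMaximal φ)
                    (M″ : Model Y) (M : Model W) →
                    Mod (θ ； φ) M″ M → Mod θ (translate φ max-φ M″) M
  Mod-；-translate θ φ max-φ M″ M =
    subst (λ ψ → ψ ≤ proj₁ M) (assoc θ φ (proj₁ M″))

  Mod-； : ∀ {W X Y} (θ : Hom W X) (φ : Hom X Y)
          (M″ : Model Y) (M′ : Model X) (M : Model W) →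
          Mod φ M″ M′ → Mod θ M′ M → Mod (θ ； φ) M″ M
  Mod-； θ φ M″ M′ M φM″≤M′ θM′≤M =
    subst (λ ψ → ψ ≤ proj₁ M) (sym (assoc θ φ (proj₁ M″)))
      (≤.trans (；-mono (≤.refl {x = θ}) φM″≤M′) θM′≤M)

mainTheorem4 : ∀ {o h r s : Level} (S : Seed o h r s) →
    let open Seed S in
    ∀ {A B} (φ : Hom A B) → SenMaximal φ → ModStrict φ
mainTheorem4 S {A} φ max-φ θ M″ M = union⊆Mod , Mod⊆union
  where
  open Seed S
  open SeedFacts S

  union⊆Mod : (Σ (Model A) λ M′ → Mod φ M″ M′ × Mod θ M′ M) → Mod (θ ； φ) M″ M
  union⊆Mod (M′ , M′∈Modφ , M∈Modθ) = Mod-； θ φ M″ M′ M M′∈Modφ M∈Modθ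

  Mod⊆union : Mod (θ ； φ) M″ M → Σ (Model A) λ M′ → Mod φ M″ M′ × Mod θ M′ M
  Mod⊆union M∈Modθφ =
    translate φ max-φ M″ , translate∈Mod φ max-φ M″ ,
    Mod-；-translate θ φ max-φ M″ M M∈Modθφ
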